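{- Let $k\geq3$, $n\ge2$, and $i,j\in[n-1]$. Suppose $\pi\in\mathcal{S}_n$ is such that $\pi$ and $\pi^k$ are both Grassmanian, with $\pi(i)=\pi^k(j)=n$ and $\pi(i+1)=\pi^k(j+1)=1$. If there exists an integer $t$ with $0\le t\le i-1$ such that $\pi(i-\ell)=\pi^k(j-\ell)=n-\ell$ for all $\ell\in[t]$, and $\pi(n)=\pi^k(n)=n-t-1$, then $i=j$ and $\pi^{k-1}=\mathrm{id}$.
   Context: $\mathcal{S}_n$ is the symmetric group on $[n]=\{1,\dots,n\}$; $[0]=\emptyset$. For $\pi\in\mathcal{S}_n$, $\operatorname{des}(\pi)$ is the number of $i\in[n-1]$ with $\pi(i)>\pi(i+1)$; $\pi$ is Grassmanian if $\operatorname{des}(\pi)\le1$. $\mathrm{id}$ is the identity permutation. -}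

module Defs where

open import Data.Nat using (ℕ; zero; suc; _+_; _∸_; _<_; _≤_; _<?_)
open import Data.Nat.Properties using (≤-refl)
open import Data.Fin using (Fin; toℕ; fromℕ<)
open import Data.Fin.Permutation using (Permutation′; _⟨$⟩ʳ_; id; _∘ₚ_)
open import Data.List using (List; length; filter; upTo)
open import Relation.Nullary.Decidable using (yes; no)

_^ₚ_ : ∀ {n} → Permutation′ n → ℕ → Permutation′ n
π ^ₚ zero = id
π ^ₚ suc k = π ∘ₚ (π ^ₚ k)

-- Permutations of [n] = {1,…,n} are encoded as permutations of Fin n,
-- with position/value p ∈ [n] represented by the Fin-index p-1.
-- ev π p = π(p) for 1 ≤ p ≤ n (1-based); returns 0 out of range.
ev : ∀ {n} → Permutation′ n → ℕ → ℕ
ev {n} π zero = zero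
ev {n} π (suc p) with p <? n
... | yes p<n = suc (toℕ (π ⟨$⟩ʳ fromℕ< p<n))
... | no _ = zero

des : ∀ {n} → Permutation′ n → ℕ
des {n} π = length (filter (λ i → ev π (suc (suc i)) <? ev π (suc i)) (upTo (n ∸ 1)))

Grassmannian : ∀ {n} → Permutation′ n → Set
Grassmannian π = des π ≤ 1

{-# OPTIONS --safe #-}
-- Write σ = π^k; it commutes with π.  From π(n) = σ(n) we get
-- π(σ(i)) = σ(π(i)) = σ(n) = π(n), so σ(i) = n = σ(j) and i = j.  A Grassmannian
-- permutation with the value 1 just after its descent i satisfies p < π(p) for
-- p ≤ i and is increasing on [i+1, n]; this holds for π and σ alike.  Two
-- commuting permutations of this shape coincide, by strong induction on x:
-- agreement at y = π⁻¹(x) gives π(x) = π(σ(y)) = σ(π(y)) = σ(x).  If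
-- y < y′ = σ⁻¹(x), then either y ≤ i, so y < π(y) = x and induction applies,
-- or σ(y) < σ(y′) = x, and agreement at σ(y) gives σ(π(y)) = π(σ(y)) = σ(σ(y)).
-- The case y′ < y is symmetric.  Hence π = π^k, i.e. π^(k-1) = id.
module Submission where

open import Defs
open import Data.Nat using (ℕ; zero; suc; _+_; _∸_; _≤_; _<_; z≤n; s≤s; s≤s⁻¹; s<s⁻¹; _<?_)
open import Data.Nat.Properties
  using (≤-refl; ≤-trans; <-trans; ≤-<-trans; <⇒≤; ≮⇒≥; ≤∧≢⇒<; m≤n⇒m<n∨m≡n;
         <⇒≢; >⇒≢; 1+n≢n; ∸-monoˡ-≤; +-comm; suc-injective)
open import Data.Fin as Fin using (Fin; toℕ; fromℕ<)
open import Data.Fin.Properties using (toℕ-injective; toℕ<n; fromℕ<-toℕ; fromℕ<-injective; <-cmp)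
open import Data.Fin.Induction using (<-wellFounded)
open import Data.Fin.Permutation using (Permutation′; _≈_; id; _⟨$⟩ʳ_; _⟨$⟩ˡ_; inverseʳ; _∘ₚ_)
open import Data.List using (List; []; _∷_; length; filter; upTo)
open import Data.List.Membership.Propositional using (_∈_)
open import Data.List.Membership.Propositional.Properties using (∈-filter⁺; ∈-upTo⁺)
open import Data.List.Relation.Unary.Any using (here)
open import Data.Product using (Σ; _×_; _,_)
open import Data.Sum using (inj₁; inj₂)
open import Function using (_∘_)
open import Function.Bundles using (Injection)
open import Function.Properties.Inverse using (↔⇒↣)
open import Induction.WellFounded using (module All)
open import Relation.Binary.Definitions using (tri<; tri≈; tri>)
open import Relation.Binary.PropositionalEquality
  using (_≡_; _≢_; refl; sym; trans; cong; subst; subst₂; module ≡-Reasoning)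
open import Relation.Nullary using (¬_; yes; no; contradiction)

open ≡-Reasoning

private
  variable
    n : ℕ

length≤1⇒∈-unique : ∀ {A : Set} {xs : List A} {x y} → length xs ≤ 1 → x ∈ xs → y ∈ xs → x ≡ y
length≤1⇒∈-unique {xs = _ ∷ []} _ (here refl) (here refl) = refl
length≤1⇒∈-unique {xs = _ ∷ _ ∷ _} (s≤s ()) _ _

⟨$⟩ʳ-injective : ∀ (π : Permutation′ n) {x y} → π ⟨$⟩ʳ x ≡ π ⟨$⟩ʳ y → x ≡ y
⟨$⟩ʳ-injective π = Injection.injective (↔⇒↣ π)

^ₚ-commute : ∀ (π : Permutation′ n) k → π ∘ₚ (π ^ₚ k) ≈ (π ^ₚ k) ∘ₚ π
^ₚ-commute π zero    x = refl
^ₚ-commute π (suc k) x = ^ₚ-commute π k (π ⟨$⟩ʳ x)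

∘ₚ-identityʳ-unique : ∀ (π ρ : Permutation′ n) → π ∘ₚ ρ ≈ π → ρ ≈ id
∘ₚ-identityʳ-unique π ρ πρ≈π y = begin
  ρ ⟨$⟩ʳ y                     ≡⟨ cong (ρ ⟨$⟩ʳ_) (inverseʳ π) ⟨
  ρ ⟨$⟩ʳ (π ⟨$⟩ʳ (π ⟨$⟩ˡ y))  ≡⟨ πρ≈π (π ⟨$⟩ˡ y) ⟩
  π ⟨$⟩ʳ (π ⟨$⟩ˡ y)            ≡⟨ inverseʳ π ⟩
  y                            ∎

-- Positions are 0-based here: toℕ x < i says that x is one of the first i positions.
record ExceedsThenIncreasing (i : ℕ) (π : Permutation′ n) : Set where
  field
    exceeds    : ∀ x → toℕ x < i → x Fin.< π ⟨$⟩ʳ x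
    increasing : ∀ {x y} → i ≤ toℕ x → x Fin.< y → π ⟨$⟩ʳ x Fin.< π ⟨$⟩ʳ y

open ExceedsThenIncreasing

module _ {π σ : Permutation′ n} (commute : π ∘ₚ σ ≈ σ ∘ₚ π) where

  agree-at-π-preimage⇒agree : ∀ x → π ⟨$⟩ʳ (π ⟨$⟩ˡ x) ≡ σ ⟨$⟩ʳ (π ⟨$⟩ˡ x) →
                              π ⟨$⟩ʳ x ≡ σ ⟨$⟩ʳ x
  agree-at-π-preimage⇒agree x agree = begin
    π ⟨$⟩ʳ x             ≡⟨ cong (π ⟨$⟩ʳ_) (inverseʳ π) ⟨
    π ⟨$⟩ʳ (π ⟨$⟩ʳ y)    ≡⟨ cong (π ⟨$⟩ʳ_) agree ⟩
    π ⟨$⟩ʳ (σ ⟨$⟩ʳ y)    ≡⟨ commute y ⟨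
    σ ⟨$⟩ʳ (π ⟨$⟩ʳ y)    ≡⟨ cong (σ ⟨$⟩ʳ_) (inverseʳ π) ⟩
    σ ⟨$⟩ʳ x             ∎
    where
    y : Fin n
    y = π ⟨$⟩ˡ x

  agree-below⇒agree-if-π-preimage-smaller :
    ∀ {i} → ExceedsThenIncreasing i π → ExceedsThenIncreasing i σ →
    ∀ x → (∀ {z} → z Fin.< x → π ⟨$⟩ʳ z ≡ σ ⟨$⟩ʳ z) →
    π ⟨$⟩ˡ x Fin.< σ ⟨$⟩ˡ x → π ⟨$⟩ʳ x ≡ σ ⟨$⟩ʳ x
  agree-below⇒agree-if-π-preimage-smaller {i} shape-π shape-σ x agree y<y′ =
    agree-at-π-preimage⇒agree x agree-at-y
    where
    y : Fin n
    y = π ⟨$⟩ˡ x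
    agree-at-y : π ⟨$⟩ʳ y ≡ σ ⟨$⟩ʳ y
    agree-at-y with toℕ y <? i
    ... | yes y<i = agree (subst (y Fin.<_) (inverseʳ π) (exceeds shape-π y y<i))
    ... | no y≮i  = ⟨$⟩ʳ-injective σ (begin
      σ ⟨$⟩ʳ (π ⟨$⟩ʳ y)  ≡⟨ commute y ⟩
      π ⟨$⟩ʳ (σ ⟨$⟩ʳ y)  ≡⟨ agree σy<x ⟩
      σ ⟨$⟩ʳ (σ ⟨$⟩ʳ y)  ∎)
      where
      σy<x : σ ⟨$⟩ʳ y Fin.< x
      σy<x = subst (σ ⟨$⟩ʳ y Fin.<_) (inverseʳ σ) (increasing shape-σ (≮⇒≥ y≮i) y<y′)

commuting-shapes⇒≈ : ∀ {i} {π σ : Permutation′ n} → π ∘ₚ σ ≈ σ ∘ₚ π →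
                     ExceedsThenIncreasing i π → ExceedsThenIncreasing i σ → π ≈ σ
commuting-shapes⇒≈ {π = π} {σ} commute shape-π shape-σ =
  All.wfRec <-wellFounded _ (λ x → π ⟨$⟩ʳ x ≡ σ ⟨$⟩ʳ x) step
  where
  step : ∀ x → (∀ {z} → z Fin.< x → π ⟨$⟩ʳ z ≡ σ ⟨$⟩ʳ z) → π ⟨$⟩ʳ x ≡ σ ⟨$⟩ʳ x
  step x agree with <-cmp (π ⟨$⟩ˡ x) (σ ⟨$⟩ˡ x)
  ... | tri< y<y′ _ _ =
    agree-below⇒agree-if-π-preimage-smaller commute shape-π shape-σ x agree y<y′
  ... | tri≈ _ y≡y′ _ = agree-at-π-preimage⇒agree {π = π} {σ} commute x (begin
    π ⟨$⟩ʳ (π ⟨$⟩ˡ x)  ≡⟨ inverseʳ π ⟩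
    x                  ≡⟨ inverseʳ σ ⟨
    σ ⟨$⟩ʳ (σ ⟨$⟩ˡ x)  ≡⟨ cong (σ ⟨$⟩ʳ_) y≡y′ ⟨
    σ ⟨$⟩ʳ (π ⟨$⟩ˡ x)  ∎)
  ... | tri> _ _ y′<y = sym
    (agree-below⇒agree-if-π-preimage-smaller (sym ∘ commute) shape-σ shape-π x (sym ∘ agree) y′<y)

module _ (π : Permutation′ n) where

  ev-fromℕ< : ∀ {p} (p<n : p < n) → ev π (suc p) ≡ suc (toℕ (π ⟨$⟩ʳ fromℕ< p<n))
  ev-fromℕ< {p} p<n with p <? n
  ... | yes _   = refl
  ... | no p≮n = contradiction p<n p≮n

  ev-toℕ : ∀ x → ev π (suc (toℕ x)) ≡ suc (toℕ (π ⟨$⟩ʳ x))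
  ev-toℕ x = trans (ev-fromℕ< (toℕ<n x)) (cong (suc ∘ toℕ ∘ (π ⟨$⟩ʳ_)) (fromℕ<-toℕ x (toℕ<n x)))

  ev-injective : ∀ {p q} → 1 ≤ p → p ≤ n → ev π p ≡ ev π q → p ≡ q
  ev-injective {suc p} {zero} _ p<n eq with () ← trans (sym (ev-fromℕ< p<n)) eq
  ev-injective {suc p} {suc q} _ p<n eq with q <? n
  ... | yes q<n = cong suc (fromℕ<-injective p q p<n q<n
                    (⟨$⟩ʳ-injective π (toℕ-injective (suc-injective (trans (sym (ev-fromℕ< p<n)) eq)))))
  ... | no _ with () ← trans (sym (ev-fromℕ< p<n)) eq

  1<ev : ∀ {p q} → 1 ≤ p → p ≤ n → ev π q ≡ 1 → p ≢ q → 1 < ev π p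
  1<ev {suc p} 1≤p p≤n πq≡1 p≢q =
    ≤∧≢⇒< 1≤πp (λ 1≡πp → p≢q (ev-injective 1≤p p≤n (trans (sym 1≡πp) (sym πq≡1))))
    where
    1≤πp : 1 ≤ ev π (suc p)
    1≤πp rewrite ev-fromℕ< p≤n = s≤s z≤n

ev-∘ₚ : ∀ (π ρ : Permutation′ n) p → ev (π ∘ₚ ρ) p ≡ ev ρ (ev π p)
ev-∘ₚ {n} π ρ zero = refl
ev-∘ₚ {n} π ρ (suc p) with p <? n
... | yes p<n = sym (ev-toℕ ρ (π ⟨$⟩ʳ fromℕ< p<n))
... | no _    = refl

ev-cong : ∀ {π ρ : Permutation′ n} → π ≈ ρ → ∀ p → ev π p ≡ ev ρ p
ev-cong {n} π≈ρ zero = refl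
ev-cong {n} π≈ρ (suc p) with p <? n
... | yes p<n = cong (suc ∘ toℕ) (π≈ρ (fromℕ< p<n))
... | no _    = refl

ev-commute : ∀ {π σ : Permutation′ n} → π ∘ₚ σ ≈ σ ∘ₚ π → ∀ p → ev σ (ev π p) ≡ ev π (ev σ p)
ev-commute {π = π} {σ} commute p = begin
  ev σ (ev π p)    ≡⟨ ev-∘ₚ π σ p ⟨
  ev (π ∘ₚ σ) p    ≡⟨ ev-cong commute p ⟩
  ev (σ ∘ₚ π) p    ≡⟨ ev-∘ₚ σ π p ⟩
  ev π (ev σ p)    ∎

DescentAt : Permutation′ n → ℕ → Set
DescentAt π p = ev π (suc p) < ev π p

grassmannian-descent-unique : ∀ {π : Permutation′ n} {p q} → Grassmannian π →
  1 ≤ p → p < n → DescentAt π p → 1 ≤ q → q < n → DescentAt π q → p ≡ q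
grassmannian-descent-unique {n} {π} {suc d} {suc e} gr _ p<n descent-p _ q<n descent-q =
  cong suc (length≤1⇒∈-unique gr (listed p<n descent-p) (listed q<n descent-q))
  where
  listed : ∀ {d} → suc d < n → DescentAt π (suc d) →
           d ∈ filter (λ d → ev π (suc (suc d)) <? ev π (suc d)) (upTo (n ∸ 1))
  listed p<n = ∈-filter⁺ _ (∈-upTo⁺ (∸-monoˡ-≤ 1 p<n))

module _ {π : Permutation′ n} (gr : Grassmannian π) {i} (1≤i : 1 ≤ i) (i<n : i < n)
         (π[1+i]≡1 : ev π (suc i) ≡ 1) where

  private
    descent : DescentAt π i
    descent = subst (_< ev π i) (sym π[1+i]≡1) (1<ev π 1≤i (<⇒≤ i<n) π[1+i]≡1 (1+n≢n ∘ sym))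

    ascent : ∀ {p} → 1 ≤ p → p < n → p ≢ i → ev π p < ev π (suc p)
    ascent {p} 1≤p p<n p≢i = ≤∧≢⇒< (≮⇒≥ no-descent) (1+n≢n ∘ sym ∘ ev-injective π 1≤p (<⇒≤ p<n))
      where
      no-descent : ¬ DescentAt π p
      no-descent descent-p = p≢i (grassmannian-descent-unique gr 1≤p p<n descent-p 1≤i i<n descent)

    exceeds-ℕ : ∀ {p} → 1 ≤ p → p ≤ i → p < ev π p
    exceeds-ℕ {1} 1≤p _ = 1<ev π 1≤p (≤-trans 1≤i (<⇒≤ i<n)) π[1+i]≡1 (<⇒≢ (s≤s 1≤i))
    exceeds-ℕ {suc (suc p)} _ 2+p≤i =
      ≤-<-trans (exceeds-ℕ (s≤s z≤n) (<⇒≤ 2+p≤i)) (ascent (s≤s z≤n) (<-trans 2+p≤i i<n) (<⇒≢ 2+p≤i))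

    increasing-ℕ : ∀ {p q} → i < p → p < q → q ≤ n → ev π p < ev π q
    increasing-ℕ {p} {suc q} i<p p<1+q 1+q≤n with m≤n⇒m<n∨m≡n (s≤s⁻¹ p<1+q)
    ... | inj₂ refl = ascent (≤-trans (s≤s z≤n) i<p) 1+q≤n (>⇒≢ i<p)
    ... | inj₁ p<q  = <-trans (increasing-ℕ i<p p<q (<⇒≤ 1+q≤n))
                              (ascent (≤-trans (s≤s z≤n) (<-trans i<p p<q)) 1+q≤n (>⇒≢ (<-trans i<p p<q)))

  grassmannian⇒exceedsThenIncreasing : ExceedsThenIncreasing i π
  grassmannian⇒exceedsThenIncreasing = record
    { exceeds    = λ x x<i → s<s⁻¹ (subst (suc (toℕ x) <_) (ev-toℕ π x) (exceeds-ℕ (s≤s z≤n) x<i))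
    ; increasing = λ {x} {y} i≤x x<y →
        s<s⁻¹ (subst₂ _<_ (ev-toℕ π x) (ev-toℕ π y) (increasing-ℕ (s≤s i≤x) (s≤s x<y) (toℕ<n y)))
    }

lemma3p1 : (k n i j : ℕ) → 3 ≤ k → 2 ≤ n →
    1 ≤ i → i ≤ n ∸ 1 → 1 ≤ j → j ≤ n ∸ 1 →
    (π : Permutation′ n) →
    Grassmannian π → Grassmannian (π ^ₚ k) →
    ev π i ≡ n → ev (π ^ₚ k) j ≡ n →
    ev π (i + 1) ≡ 1 → ev (π ^ₚ k) (j + 1) ≡ 1 →
    Σ ℕ (λ t → t ≤ i ∸ 1 ×
      ((ℓ : ℕ) → 1 ≤ ℓ → ℓ ≤ t →
        ev π (i ∸ ℓ) ≡ n ∸ ℓ × ev (π ^ₚ k) (j ∸ ℓ) ≡ n ∸ ℓ) ×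
      ev π n ≡ n ∸ t ∸ 1 × ev (π ^ₚ k) n ≡ n ∸ t ∸ 1) →
    i ≡ j × (π ^ₚ (k ∸ 1)) ≈ id
lemma3p1 (suc k) (suc n) i j (s≤s _) (s≤s _) 1≤i i≤n _ _ π gr-π gr-σ πi≡n σj≡n π[i+1]≡1 σ[j+1]≡1
         (_ , _ , _ , πn≡ , σn≡) =
  i≡j , ∘ₚ-identityʳ-unique π (π ^ₚ k) (sym ∘ π≈σ)
  where
  σ : Permutation′ (suc n)
  σ = π ^ₚ suc k

  commute : π ∘ₚ σ ≈ σ ∘ₚ π
  commute = ^ₚ-commute π (suc k)

  i<n : i < suc n
  i<n = s≤s i≤n

  σi≡n : ev σ i ≡ suc n
  σi≡n = sym (ev-injective π (s≤s z≤n) ≤-refl (begin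
    ev π (suc n)       ≡⟨ trans πn≡ (sym σn≡) ⟩
    ev σ (suc n)       ≡⟨ cong (ev σ) πi≡n ⟨
    ev σ (ev π i)      ≡⟨ ev-commute commute i ⟩
    ev π (ev σ i)      ∎))

  i≡j : i ≡ j
  i≡j = ev-injective σ 1≤i (<⇒≤ i<n) (trans σi≡n (sym σj≡n))

  σ[1+i]≡1 : ev σ (suc i) ≡ 1
  σ[1+i]≡1 = trans (cong (ev σ) (+-comm 1 i)) (subst (λ m → ev σ (m + 1) ≡ 1) (sym i≡j) σ[j+1]≡1)

  π≈σ : π ≈ σ
  π≈σ = commuting-shapes⇒≈ commute
    (grassmannian⇒exceedsThenIncreasing gr-π 1≤i i<n (trans (cong (ev π) (+-comm 1 i)) π[i+1]≡1))
    (grassmannian⇒exceedsThenIncreasing gr-σ 1≤i i<n σ[1+i]≡1)
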